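{- If $H$ is a connected graph and $n\ge 1$, then $\mathrm{gp}_{\rm d}(K_n\boxtimes H)=n\cdot\mathrm{gp}_{\rm d}(H)$.
   Context: All graphs are finite and simple. For $X\subseteq V(G)$, two vertices $u,v$ are $X$-positionable if no shortest $u,v$-path has an internal vertex in $X$. $X$ is a dual general position set if every two vertices of $X$ are $X$-positionable and every two vertices of $V(G)\setminus X$ are $X$-positionable; $\mathrm{gp}_{\rm d}(G)$ is the maximum cardinality of such a set. The strong product $G\boxtimes H$ has vertex set $V(G)\times V(H)$, with $(g,h)$ and $(g',h')$ adjacent iff either $g=g'$ and $hh'\in E(H)$, or $gg'\in E(G)$ and $h=h'$, or $gg'\in E(G)$ and $hh'\in E(H)$. $K_n$ is the complete graph on $n$ vertices. -}

module Defs where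

open import Data.Nat using (ℕ; zero; suc; _*_; _≤_)
open import Data.Fin using (Fin; _≟_; remQuot)
open import Data.Fin.Subset using (Subset; _∈_; _∉_; ∣_∣)
open import Data.Bool using (Bool; true; false; not; _∧_; _∨_)
open import Data.Product using (Σ; ∃; _×_; _,_; proj₁; proj₂)
open import Relation.Nullary using (¬_)
open import Relation.Nullary.Decidable using (⌊_⌋)
open import Relation.Binary.PropositionalEquality using (_≡_)

record Graph : Set where
  field
    order : ℕ
    adj   : Fin order → Fin order → Bool
open Graph public

record IsSimple (G : Graph) : Set where
  field
    sym   : ∀ u v → adj G u v ≡ true → adj G v u ≡ true
    irrefl : ∀ u → adj G u u ≡ false

data Walk (G : Graph) : Fin (order G) → Fin (order G) → ℕ → Set where
  nil  : ∀ {u} → Walk G u u zero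
  cons : ∀ {u w v k} → adj G u w ≡ true → Walk G w v k → Walk G u v (suc k)

-- x is an internal vertex of the walk (neither the first nor the last vertex).
data Inner {G : Graph} : ∀ {u v k} → Walk G u v k → Fin (order G) → Set where
  here  : ∀ {u w v k} (e : adj G u w ≡ true) (p : Walk G w v (suc k)) →
          Inner (cons e p) w
  there : ∀ {u w v k x} {e : adj G u w ≡ true} {p : Walk G w v k} →
          Inner p x → Inner (cons e p) x

Connected : Graph → Set
Connected G = ∀ u v → ∃ λ k → Walk G u v k

-- A walk is a shortest u,v-path if no u,v-walk is shorter
-- (such a walk is automatically a path).
IsShortest : ∀ {G u v k} → Walk G u v k → Set
IsShortest {G} {u} {v} {k} _ = ∀ {k'} → Walk G u v k' → k ≤ k'

Positionable : (G : Graph) → Subset (order G) → Fin (order G) → Fin (order G) → Set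
Positionable G X u v =
  ∀ {k} (p : Walk G u v k) → IsShortest p → ∀ x → Inner p x → x ∉ X

IsDualGP : (G : Graph) → Subset (order G) → Set
IsDualGP G X =
  (∀ u v → u ∈ X → v ∈ X → Positionable G X u v) ×
  (∀ u v → u ∉ X → v ∉ X → Positionable G X u v)

IsGpd : Graph → ℕ → Set
IsGpd G m =
  (Σ (Subset (order G)) λ X → IsDualGP G X × ∣ X ∣ ≡ m) ×
  (∀ X → IsDualGP G X → ∣ X ∣ ≤ m)

K : ℕ → Graph
K n = record { order = n ; adj = λ i j → not ⌊ i ≟ j ⌋ }

-- Strong product; vertex (g , h) is encoded as combine g h : Fin (order G * order H).
_⊠_ : Graph → Graph → Graph
G ⊠ H = record
  { order = order G * order H
  ; adj = λ a b →
      let g  = proj₁ (remQuot {order G} (order H) a) ; h  = proj₂ (remQuot {order G} (order H) a)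
          g' = proj₁ (remQuot {order G} (order H) b) ; h' = proj₂ (remQuot {order G} (order H) b)
      in (⌊ g ≟ g' ⌋ ∧ adj H h h')
         ∨ (adj G g g' ∧ ⌊ h ≟ h' ⌋)
         ∨ (adj G g g' ∧ adj H h h')
  }

-- In K n ⊠ H the vertices (i , h) and (j , h') are at distance max (d_H(h , h'), 1) when
-- distinct, so every shortest path with an internal vertex (length ≥ 2) projects onto a
-- shortest path of H, and every shortest path of H lifts, through any chosen layer, to a
-- shortest path of the product.  Hence the blow-up K n × X of a dual general position set X
-- of H is one of the product, and conversely the shadow {h ∣ ∃ i. (i , h) ∈ Y} of a dual
-- general position set Y of the product is one of H, while ∣ Y ∣ ≤ n · ∣ shadow Y ∣.
module Submission where

open import Defs
open import Data.Bool using (true; false; _∧_; _∨_)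
open import Data.Bool.Properties using (T-≡)
open import Data.Empty using (⊥-elim)
import Data.Fin as Fin
open import Data.Fin using (Fin; combine; remQuot; _≟_)
open import Data.Fin.Properties using (any?; combine-remQuot; remQuot-combine)
open import Data.Fin.Subset using (Subset; _∈_; _∉_; _⊆_; ∣_∣; inside; outside)
open import Data.Fin.Subset.Properties using (_∈?_; p⊆q⇒∣p∣≤∣q∣)
open import Data.Nat using (ℕ; zero; suc; _+_; _*_; _≤_; _≥_; z≤n; s≤s)
open import Data.Nat.Properties
  using (≤-refl; ≤-trans; ≤-antisym; m≤n⇒m≤1+n; +-monoˡ-≤; +-monoʳ-≤; +-cancelˡ-≤; +-cancelʳ-≤; *-monoʳ-≤)
open import Data.Product using (Σ; ∃; ∃₂; _×_; _,_; proj₁; proj₂)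
open import Data.Sum using (_⊎_; inj₁; inj₂)
open import Data.Vec using ([]; _∷_; _++_; concat; replicate; lookup; tabulate)
open import Data.Vec.Properties using ([]=⇒lookup; lookup⇒[]=; lookup-concat; lookup-replicate; lookup∘tabulate)
open import Function using (_∘_)
open import Function.Bundles using (Equivalence)
open import Relation.Nullary using (does; yes; no)
open import Relation.Nullary.Decidable using (⌊_⌋; dec-true; toWitness)
open import Relation.Binary.PropositionalEquality

private variable m n : ℕ

+-squeeze : ∀ {a b c d} → a ≤ c → b ≤ d → c + d ≤ a + b → a ≡ c × b ≡ d
+-squeeze {a} {b} {c} {d} a≤c b≤d c+d≤a+b =
  ≤-antisym a≤c (+-cancelʳ-≤ d c a (≤-trans c+d≤a+b (+-monoʳ-≤ a b≤d))) ,
  ≤-antisym b≤d (+-cancelˡ-≤ c d b (≤-trans c+d≤a+b (+-monoˡ-≤ b a≤c)))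

∧∨-true⇒ : ∀ d t e x → (d ∧ t) ∨ (x ∧ e) ∨ (x ∧ t) ≡ true → t ≡ true ⊎ e ≡ true
∧∨-true⇒ _     true  _     _     _  = inj₁ refl
∧∨-true⇒ _     _     true  _     _  = inj₂ refl
∧∨-true⇒ true  false false true  ()
∧∨-true⇒ true  false false false ()
∧∨-true⇒ false false false true  ()
∧∨-true⇒ false false false false ()

∈-resp-lookup : {p : Subset m} {q : Subset n} {x : Fin m} {y : Fin n} →
  lookup p x ≡ lookup q y → x ∈ p → y ∈ q
∈-resp-lookup {q = q} {y = y} eq x∈p = lookup⇒[]= y q (trans (sym eq) ([]=⇒lookup x∈p))

∣p++q∣≡∣p∣+∣q∣ : (p : Subset m) (q : Subset n) → ∣ p ++ q ∣ ≡ ∣ p ∣ + ∣ q ∣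
∣p++q∣≡∣p∣+∣q∣ []            q = refl
∣p++q∣≡∣p∣+∣q∣ (inside  ∷ p) q = cong suc (∣p++q∣≡∣p∣+∣q∣ p q)
∣p++q∣≡∣p∣+∣q∣ (outside ∷ p) q = ∣p++q∣≡∣p∣+∣q∣ p q

-- Fin (n * m) is read as Fin n × Fin m through combine / remQuot, as in _⊠_;
-- blowup n X is then Fin n × X.
blowup : (n : ℕ) → Subset m → Subset (n * m)
blowup n X = concat (replicate n X)

lookup-blowup : (X : Subset m) (a : Fin (n * m)) →
  lookup (blowup n X) a ≡ lookup X (proj₂ (remQuot {n} m a))
lookup-blowup {m = m} {n = n} X a = begin
  lookup (blowup n X) a               ≡⟨ cong (lookup (blowup n X)) (sym (combine-remQuot {n} m a)) ⟩
  lookup (blowup n X) (combine i h)   ≡⟨ lookup-concat (replicate n X) i h ⟩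
  lookup (lookup (replicate n X) i) h ≡⟨ cong (λ Z → lookup Z h) (lookup-replicate i X) ⟩
  lookup X h                          ∎
  where
  open ≡-Reasoning
  i = proj₁ (remQuot {n} m a)
  h = proj₂ (remQuot {n} m a)

∣blowup∣ : (n : ℕ) (X : Subset m) → ∣ blowup n X ∣ ≡ n * ∣ X ∣
∣blowup∣ zero    X = refl
∣blowup∣ (suc n) X = trans (∣p++q∣≡∣p∣+∣q∣ X (blowup n X)) (cong (∣ X ∣ +_) (∣blowup∣ n X))

shadow : (n : ℕ) → Subset (n * m) → Subset m
shadow n Y = tabulate (λ h → does (any? (λ (i : Fin n) → combine i h ∈? Y)))

∈-shadow⁺ : {Y : Subset (n * m)} (i : Fin n) {h : Fin m} → combine i h ∈ Y → h ∈ shadow n Y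
∈-shadow⁺ {Y = Y} i {h} i,h∈Y =
  lookup⇒[]= h _ (trans (lookup∘tabulate _ h) (dec-true (any? λ j → combine j h ∈? Y) (i , i,h∈Y)))

∈-shadow⁻ : {Y : Subset (n * m)} {h : Fin m} → h ∈ shadow n Y → ∃ λ (i : Fin n) → combine i h ∈ Y
∈-shadow⁻ {n = n} {Y = Y} {h} h∈Z
  with any? (λ (i : Fin n) → combine i h ∈? Y) | trans (sym (lookup∘tabulate _ h)) ([]=⇒lookup h∈Z)
... | yes i,h∈Y | _  = i,h∈Y
... | no  _     | ()

⊆-blowup-shadow : (Y : Subset (n * m)) → Y ⊆ blowup n (shadow n Y)
⊆-blowup-shadow {n = n} {m = m} Y {a} a∈Y =
  ∈-resp-lookup (sym (lookup-blowup {n = n} (shadow n Y) a))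
    (∈-shadow⁺ {Y = Y} (proj₁ (remQuot {n} m a)) (subst (_∈ Y) (sym (combine-remQuot {n} m a)) a∈Y))

∣Y∣≤n*∣shadow∣ : (n : ℕ) (Y : Subset (n * m)) → ∣ Y ∣ ≤ n * ∣ shadow n Y ∣
∣Y∣≤n*∣shadow∣ n Y = subst (∣ Y ∣ ≤_) (∣blowup∣ n (shadow n Y)) (p⊆q⇒∣p∣≤∣q∣ (⊆-blowup-shadow {n = n} Y))

module _ {G : Graph} where

  _++ʷ_ : ∀ {u w v a b} → Walk G u w a → Walk G w v b → Walk G u v (a + b)
  nil      ++ʷ q = q
  cons e p ++ʷ q = cons e (p ++ʷ q)

  walk-length-0 : ∀ {u v} → Walk G u v 0 → u ≡ v
  walk-length-0 nil = refl

  inner⇒2≤length : ∀ {u v k x} {p : Walk G u v k} → Inner p x → 2 ≤ k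
  inner⇒2≤length (here _ _) = s≤s (s≤s z≤n)
  inner⇒2≤length (there i)  = m≤n⇒m≤1+n (inner⇒2≤length i)

  splitAt-inner : ∀ {u v k x} (p : Walk G u v k) → Inner p x →
    ∃₂ λ a b → suc a + suc b ≡ k × Walk G u x (suc a) × Walk G x v (suc b)
  splitAt-inner (cons e p) (here .e .p) = 0 , _ , refl , cons e nil , p
  splitAt-inner (cons e p) (there i) with splitAt-inner p i
  ... | a , b , refl , p₁ , p₂ = suc a , b , refl , cons e p₁ , p₂

  join-inner : ∀ {u x v a b} → Walk G u x (suc a) → Walk G x v (suc b) →
    Σ (Walk G u v (suc a + suc b)) λ p → Inner p x
  join-inner (cons e nil)          q = cons e q , here e q
  join-inner (cons e p@(cons _ _)) q with join-inner p q
  ... | w , i = cons e w , there i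

DistAtLeast : (G : Graph) → Fin (order G) → Fin (order G) → ℕ → Set
DistAtLeast G u v k = ∀ {k'} → Walk G u v k' → k ≤ k'

module StrongProduct (G H : Graph) where

  πG : Fin (order (G ⊠ H)) → Fin (order G)
  πG a = proj₁ (remQuot {order G} (order H) a)

  πH : Fin (order (G ⊠ H)) → Fin (order H)
  πH a = proj₂ (remQuot {order G} (order H) a)

  πH-combine : ∀ g h → πH (combine g h) ≡ h
  πH-combine g h = cong proj₂ (remQuot-combine {order G} {order H} g h)

  π-injective : ∀ {a b} → πG a ≡ πG b → πH a ≡ πH b → a ≡ b
  π-injective {a} {b} g≡ h≡ = begin
    a                     ≡⟨ sym (combine-remQuot {order G} (order H) a) ⟩
    combine (πG a) (πH a) ≡⟨ cong₂ combine g≡ h≡ ⟩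
    combine (πG b) (πH b) ≡⟨ combine-remQuot {order G} (order H) b ⟩
    b                     ∎
    where open ≡-Reasoning

  adj-πH : ∀ a b → adj (G ⊠ H) a b ≡ true → adj H (πH a) (πH b) ≡ true ⊎ πH a ≡ πH b
  adj-πH a b e
    with ∧∨-true⇒ ⌊ πG a ≟ πG b ⌋ (adj H (πH a) (πH b)) ⌊ πH a ≟ πH b ⌋ (adj G (πG a) (πG b)) e
  ... | inj₁ adjH = inj₁ adjH
  ... | inj₂ h≡   = inj₂ (toWitness {a? = πH a ≟ πH b} (Equivalence.from T-≡ h≡))

  project : ∀ {a b k} → Walk (G ⊠ H) a b k → ∃ λ k' → k' ≤ k × Walk H (πH a) (πH b) k'
  project nil = 0 , z≤n , nil
  project (cons {u} {w} e p) with project p | adj-πH u w e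
  ... | k' , k'≤k , q | inj₁ adjH = suc k' , s≤s k'≤k , cons adjH q
  ... | k' , k'≤k , q | inj₂ h≡   = k' , m≤n⇒m≤1+n k'≤k , subst (λ h → Walk H h _ k') (sym h≡) q

  distAtLeast-lift : ∀ {a b k} → DistAtLeast H (πH a) (πH b) k → DistAtLeast (G ⊠ H) a b k
  distAtLeast-lift d p with project p
  ... | k' , k'≤ , q = ≤-trans (d q) k'≤

module CompleteLayers (n : ℕ) (H : Graph) where

  open StrongProduct (K n) H public

  P : Graph
  P = K n ⊠ H

  adj-lift : ∀ a b → adj H (πH a) (πH b) ≡ true → adj P a b ≡ true
  adj-lift a b e rewrite e with πG a ≟ πG b
  ... | yes _ = refl
  ... | no _  with πH a ≟ πH b
  ...   | yes _ = refl
  ...   | no _  = refl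

  adj-fibre : ∀ a b → πH a ≡ πH b → a ≢ b → adj P a b ≡ true
  adj-fibre a b h≡ a≢b with πG a ≟ πG b
  ... | yes g≡ = ⊥-elim (a≢b (π-injective g≡ h≡))
  ... | no _  with πH a ≟ πH b
  ...   | yes _ = refl
  ...   | no h≢ = ⊥-elim (h≢ h≡)

  lift : ∀ {a b r} → Walk H (πH a) (πH b) (suc r) → Walk P a b (suc r)
  lift q = go q refl refl
    where
    go : ∀ {a b h h' r} → Walk H h h' (suc r) → πH a ≡ h → πH b ≡ h' → Walk P a b (suc r)
    go {a} {b} (cons e nil) refl refl = cons (adj-lift a b e) nil
    go {a} (cons {w = w} e q@(cons _ _)) refl b≡ =
      cons (adj-lift a c (subst (λ h → adj H (πH a) h ≡ true) (sym (πH-combine (πG a) w)) e))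
           (go q (πH-combine (πG a) w) b≡)
      where c = combine (πG a) w

  walk-within-fibre : ∀ a b → πH a ≡ πH b → ∃ λ k → k ≤ 1 × Walk P a b k
  walk-within-fibre a b h≡ with a ≟ b
  ... | yes refl = 0 , z≤n , nil
  ... | no a≢b   = 1 , ≤-refl , cons (adj-fibre a b h≡ a≢b) nil

  distAtLeast-project : ∀ {a b k} → 2 ≤ k → DistAtLeast P a b k → DistAtLeast H (πH a) (πH b) k
  distAtLeast-project {a} {b} 2≤k d {zero} q with walk-within-fibre a b (walk-length-0 q)
  ... | k' , k'≤1 , p with ≤-trans 2≤k (≤-trans (d p) k'≤1)
  ...   | s≤s ()
  distAtLeast-project 2≤k d {suc r} q = d (lift q)

  shortest-through-project : ∀ {u v k x} (p : Walk P u v k) → IsShortest p → Inner p x →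
    Σ (Walk H (πH u) (πH v) k) λ q → IsShortest q × Inner q (πH x)
  shortest-through-project p p-shortest x-inner
    with distAtLeast-project (inner⇒2≤length x-inner) p-shortest | splitAt-inner p x-inner
  ... | dist-bound | a , b , refl , p₁ , p₂ with project p₁ | project p₂
  -- projecting the two halves cannot shorten them, as their concatenation is still shortest
  ... | a' , a'≤ , q₁ | b' , b'≤ , q₂ with +-squeeze a'≤ b'≤ (dist-bound (q₁ ++ʷ q₂))
  ... | refl , refl = let (q , πx-inner) = join-inner q₁ q₂ in q , dist-bound , πx-inner

  shortest-through-lift : ∀ {u v k x} (q : Walk H (πH u) (πH v) k) → IsShortest q → Inner q (πH x) →
    Σ (Walk P u v k) λ p → IsShortest p × Inner p x
  shortest-through-lift q q-shortest x-inner with splitAt-inner q x-inner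
  ... | a , b , refl , q₁ , q₂ =
    let (p , x-inner′) = join-inner (lift q₁) (lift q₂) in p , distAtLeast-lift q-shortest , x-inner′

  ∈-blowup⁺ : ∀ {X a} → πH a ∈ X → a ∈ blowup n X
  ∈-blowup⁺ {X} {a} = ∈-resp-lookup (sym (lookup-blowup {n = n} X a))

  ∈-blowup⁻ : ∀ {X a} → a ∈ blowup n X → πH a ∈ X
  ∈-blowup⁻ {X} {a} = ∈-resp-lookup (lookup-blowup {n = n} X a)

  positionable-blowup : ∀ {X u v} → Positionable H X (πH u) (πH v) → Positionable P (blowup n X) u v
  positionable-blowup pos p p-shortest x x-inner x∈ =
    let (q , q-shortest , πx-inner) = shortest-through-project p p-shortest x-inner
    in pos q q-shortest (πH x) πx-inner (∈-blowup⁻ x∈)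

  positionable-shadow : ∀ {Y u v} → Positionable P Y u v → Positionable H (shadow n Y) (πH u) (πH v)
  positionable-shadow pos q q-shortest y y-inner y∈ =
    let (i , i,y∈Y) = ∈-shadow⁻ y∈
        (p , p-shortest , x-inner) =
          shortest-through-lift q q-shortest (subst (Inner q) (sym (πH-combine i y)) y-inner)
    in pos p p-shortest (combine i y) x-inner i,y∈Y

  isDualGP-blowup : ∀ {X} → IsDualGP H X → IsDualGP P (blowup n X)
  isDualGP-blowup (in-X , out-X) =
    (λ u v u∈ v∈ → positionable-blowup (in-X _ _ (∈-blowup⁻ u∈) (∈-blowup⁻ v∈))) ,
    (λ u v u∉ v∉ → positionable-blowup (out-X _ _ (u∉ ∘ ∈-blowup⁺) (v∉ ∘ ∈-blowup⁺)))

  isDualGP-shadow : ∀ {Y} → Fin n → IsDualGP P Y → IsDualGP H (shadow n Y)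
  isDualGP-shadow {Y} i₀ (in-Y , out-Y) = in-Z , out-Z
    where
    positionable-shadow-at : ∀ i j h h' → Positionable P Y (combine i h) (combine j h') →
      Positionable H (shadow n Y) h h'
    positionable-shadow-at i j h h' =
      subst₂ (Positionable H (shadow n Y)) (πH-combine i h) (πH-combine j h') ∘ positionable-shadow

    in-Z : ∀ h h' → h ∈ shadow n Y → h' ∈ shadow n Y → Positionable H (shadow n Y) h h'
    in-Z h h' h∈ h'∈ =
      let (i , i,h∈Y) = ∈-shadow⁻ h∈ ; (j , j,h'∈Y) = ∈-shadow⁻ h'∈
      in positionable-shadow-at i j h h' (in-Y _ _ i,h∈Y j,h'∈Y)

    out-Z : ∀ h h' → h ∉ shadow n Y → h' ∉ shadow n Y → Positionable H (shadow n Y) h h'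
    out-Z h h' h∉ h'∉ =
      positionable-shadow-at i₀ i₀ h h' (out-Y _ _ (h∉ ∘ ∈-shadow⁺ i₀) (h'∉ ∘ ∈-shadow⁺ i₀))

theorem4p7 : (H : Graph) → IsSimple H → Connected H →
    (n : ℕ) → n ≥ 1 → (m : ℕ) → IsGpd H m → IsGpd (K n ⊠ H) (n * m)
theorem4p7 H _ _ (suc n) _ m ((X , X-dual , ∣X∣≡m) , X-maximum) =
  (blowup (suc n) X , isDualGP-blowup X-dual , trans (∣blowup∣ (suc n) X) (cong (suc n *_) ∣X∣≡m)) ,
  λ Y Y-dual → ≤-trans (∣Y∣≤n*∣shadow∣ (suc n) Y)
                       (*-monoʳ-≤ (suc n) (X-maximum (shadow (suc n) Y) (isDualGP-shadow Fin.zero Y-dual)))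
  where open CompleteLayers (suc n) H
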